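{- Let $k\ge1$ and let $\mathcal{S}(n,k)$ be the number of bits required to store an encoding of sorted range top-$k$ queries on an array $A[1..n]$. Then at least $\mathcal{S}(n-k,k)$ bits are required to store an encoding of unsorted range top-$k$ queries on an array $A[1..n]$.
   Context: A sorted range top-$k$ query on a range $[i,j]$ returns the indices $i_1,\dots,i_k$ of the $k$ largest values of $A[i..j]$ in order, i.e. $A[i_m]$ is the $m$-th largest value. An unsorted range top-$k$ query returns the same set of indices in an arbitrary order. An encoding of a query type is a representation (computed from $A$) from which the answers to all queries of that type on all ranges can be recovered; the number of bits required is the worst case over arrays of the given length. -}

module Defs where

open import Data.Nat using (ℕ; zero; suc; _≤_; _<_; _⊓_; _∸_)
open import Data.Fin using (Fin; toℕ)
open import Data.Bool using (Bool)
open import Data.Vec using (Vec)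
open import Data.List using (List; length)
open import Data.List.Relation.Unary.All using (All)
open import Data.List.Relation.Unary.Linked using (Linked)
open import Data.List.Membership.Propositional using (_∈_; _∉_)
open import Data.Product using (Σ; ∃; _×_; proj₁)
open import Function.Definitions using (Injective)
open import Relation.Binary.PropositionalEquality using (_≡_)
open import Data.Fin.Subset as Sub using (Subset)

Array : ℕ → Set
Array n = Σ (Fin n → ℕ) (Injective _≡_ _≡_)

val : ∀ {n} → Array n → Fin n → ℕ
val A = proj₁ A

InRange : ∀ {n} → Fin n → Fin n → Fin n → Set
InRange i j x = toℕ i ≤ toℕ x × toℕ x ≤ toℕ j

-- L is the answer to the sorted range top-k query on [i,j]:
-- the indices of the min(k, j-i+1) largest values of A[i..j],
-- listed in decreasing order of value.
IsSortedTopK : ∀ {n} → Array n → ℕ → Fin n → Fin n → List (Fin n) → Set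
IsSortedTopK A k i j L =
  (length L ≡ k ⊓ (suc (toℕ j) ∸ toℕ i)) ×
  All (InRange i j) L ×
  Linked (λ x y → val A y < val A x) L ×
  (∀ x → InRange i j x → x ∉ L → All (λ y → val A x < val A y) L)

IsUnsortedTopK : ∀ {n} → Array n → ℕ → Fin n → Fin n → Subset n → Set
IsUnsortedTopK A k i j S =
  ∃ λ L → IsSortedTopK A k i j L ×
          (∀ x → (x Sub.∈ S → x ∈ L) × (x ∈ L → x Sub.∈ S))

-- An encoding with b bits for a query type whose answers live in Ans and
-- are specified by Correct: an encoder from arrays to b-bit strings and a
-- decoder recovering the answers to all queries on all ranges [i,j], i ≤ j.
Encodable : (Ans : ℕ → Set)
          → (Correct : ∀ {n} → Array n → Fin n → Fin n → Ans n → Set)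
          → ℕ → ℕ → Set
Encodable Ans Correct n b =
  Σ (Array n → Vec Bool b) λ enc →
  Σ (Vec Bool b → (i j : Fin n) → Ans n) λ dec →
  ∀ (A : Array n) (i j : Fin n) → toℕ i ≤ toℕ j → Correct A i j (dec (enc A) i j)

SortedEncodable : ℕ → ℕ → ℕ → Set
SortedEncodable k = Encodable (λ n → List (Fin n)) (λ A i j L → IsSortedTopK A k i j L)

UnsortedEncodable : ℕ → ℕ → ℕ → Set
UnsortedEncodable k = Encodable Subset (λ A i j S → IsUnsortedTopK A k i j S)

-- s is the number of bits required (worst case) for an encoding:
-- the minimum b for which an encoding with b bits exists.
IsBitsRequired : (ℕ → ℕ → Set) → ℕ → ℕ → Set
IsBitsRequired Enc n s = Enc n s × (∀ b → Enc n b → s ≤ b)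

-- Append k positions to B (of length n ∸ k) whose values increase and exceed every value of B.
-- A sorted top-k query on B[i..j] is answered from unsorted top-k queries on the padded array A
-- by shrinking the range [i, r] from r = n − 1 down to r = j. At r = n − 1 the top k are exactly
-- the padded positions. Each step removes one position, so at most one position enters the top k,
-- and it is smaller than every element already there; hence the positions of B[i..j] appear in
-- decreasing order of value when listed in order of entry. So any encoding of A's unsorted answers
-- yields an encoding of B's sorted answers with the same number of bits.
module Submission where

open import Defs
open import Data.Nat using (ℕ; zero; suc; _+_; _≤_; _<_; _>_; _⊓_; _∸_; z≤n; s≤s; s≤s⁻¹; _≤?_)
open import Data.Nat.Properties
open import Data.Bool using (false)
open import Data.Vec using (replicate)
open import Data.Fin using (Fin; toℕ; fromℕ; fromℕ<; splitAt; join; _↑ˡ_; _↑ʳ_)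
open import Data.Fin.Properties
  using (toℕ-injective; toℕ<n; toℕ-fromℕ; toℕ-fromℕ<; fromℕ<-toℕ; toℕ-↑ˡ; toℕ-↑ʳ;
         ↑ˡ-injective; ↑ʳ-injective; splitAt-↑ˡ; splitAt-↑ʳ; splitAt-<; splitAt⁻¹-↑ˡ; join-splitAt)
  renaming (_≟_ to _≟ᶠ_)
open import Data.Fin.Subset using (Subset) renaming (_∈_ to _∈ₛ_)
open import Data.Fin.Subset.Properties using () renaming (_∈?_ to _∈ₛ?_)
open import Data.List
  using (List; []; _∷_; length; map; filter; _++_; allFin; tabulate; applyUpTo; mapMaybe)
open import Data.List.Properties
  using (length-map; length-tabulate; length-applyUpTo; length-removeAt′;
         filter-all; filter-none; ++-assoc; ++-identityʳ)
open import Data.List.Extrema.Nat using (max; xs≤max)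
open import Data.List.Relation.Unary.All as All using (All; []; _∷_)
open import Data.List.Relation.Unary.All.Properties using (¬Any⇒All¬)
import Data.List.Relation.Unary.All.Properties as All
open import Data.List.Relation.Unary.AllPairs as AllPairs using ([]; _∷_)
open import Data.List.Relation.Unary.Any as Any using (here; there; index)
open import Data.List.Relation.Unary.Linked as Linked using (Linked; []; [-]; _∷_)
import Data.List.Relation.Unary.Linked.Properties as Linked
open import Data.List.Relation.Unary.Unique.Propositional using (Unique)
import Data.List.Relation.Unary.Unique.Propositional.Properties as Unique
open import Data.List.Relation.Binary.Subset.Propositional using (_⊆_)
open import Data.List.Membership.Propositional using (_∈_; _∉_; _─_)
open import Data.List.Membership.Propositional.Properties
  using (∈-map⁺; ∈-map⁻; ∈-allFin; ∈-applyUpTo⁺; ∈-filter⁺; ∈-filter⁻; ∈-++⁺ˡ; ∈-++⁺ʳ; ∈-++⁻)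
open import Data.Product using (_×_; _,_; proj₁; proj₂)
open import Data.Sum using (_⊎_; inj₁; inj₂; isInj₁)
open import Data.Empty using (⊥-elim)
open import Function using (_∘_; _on_)
open import Function.Definitions using (Injective)
open import Relation.Nullary using (¬_; yes; no; ¬?)
open import Relation.Nullary.Decidable using (_×-dec_)
open import Relation.Unary using (Decidable)
open import Relation.Binary.PropositionalEquality

module _ {X : Set} where

  ∈-─ : ∀ {x z : X} {ys} (x∈ys : x ∈ ys) → z ∈ ys → z ≢ x → z ∈ ys ─ x∈ys
  ∈-─ (here refl) (here refl) z≢x = ⊥-elim (z≢x refl)
  ∈-─ (here refl) (there z∈ys) _ = z∈ys
  ∈-─ (there x∈ys) (here refl) _ = here refl
  ∈-─ (there x∈ys) (there z∈ys) z≢x = there (∈-─ x∈ys z∈ys z≢x)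

  unique-⊆⇒length≤ : ∀ {xs ys : List X} → Unique xs → xs ⊆ ys → length xs ≤ length ys
  unique-⊆⇒length≤ {[]} _ _ = z≤n
  unique-⊆⇒length≤ {x ∷ xs} {ys} (x∉xs ∷ xs!) x∷xs⊆ys = begin
      suc (length xs)          ≤⟨ s≤s (unique-⊆⇒length≤ xs! xs⊆ys─x) ⟩
      suc (length (ys ─ x∈ys)) ≡⟨ length-removeAt′ ys (index x∈ys) ⟨
      length ys                ∎
    where
    open ≤-Reasoning
    x∈ys : x ∈ ys
    x∈ys = x∷xs⊆ys (here refl)
    xs⊆ys─x : xs ⊆ ys ─ x∈ys
    xs⊆ys─x z∈xs = ∈-─ x∈ys (x∷xs⊆ys (there z∈xs)) (All.lookup x∉xs z∈xs ∘ sym)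

  linked-++⁺ : ∀ {R : X → X → Set} {xs ys} → Linked R xs → Linked R ys
             → (∀ {x y} → x ∈ xs → y ∈ ys → R x y) → Linked R (xs ++ ys)
  linked-++⁺ [] Rys _ = Rys
  linked-++⁺ {ys = []} [-] _ _ = [-]
  linked-++⁺ {ys = y ∷ _} [-] Rys R⟨xs,ys⟩ = R⟨xs,ys⟩ (here refl) (here refl) ∷ Rys
  linked-++⁺ (Rxy ∷ Rxs) Rys R⟨xs,ys⟩ = Rxy ∷ linked-++⁺ Rxs Rys (R⟨xs,ys⟩ ∘ there)

  linked-≤1 : ∀ {R : X → X → Set} {xs} → Unique xs → (∀ {x y} → x ∈ xs → y ∈ xs → x ≡ y)
            → Linked R xs
  linked-≤1 {xs = []} _ _ = []
  linked-≤1 {xs = _ ∷ []} _ _ = [-]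
  linked-≤1 {xs = _ ∷ _ ∷ _} ((x≢y ∷ _) ∷ _) same =
    ⊥-elim (x≢y (same (here refl) (there (here refl))))

  ∉⇒unique-∷ : ∀ {x : X} {xs} → x ∉ xs → Unique xs → Unique (x ∷ xs)
  ∉⇒unique-∷ {xs = xs} x∉xs xs! = ¬Any⇒All¬ xs x∉xs ∷ xs!

module Descending {X : Set} (v : X → ℕ) where

  >-trans : ∀ {x y z} → (_>_ on v) x y → (_>_ on v) y z → (_>_ on v) x z
  >-trans x>y y>z = <-trans y>z x>y

  descending⇒unique : ∀ {xs} → Linked (_>_ on v) xs → Unique xs
  descending⇒unique desc =
    AllPairs.map (λ x>y x≡y → <-irrefl (cong v (sym x≡y)) x>y) (Linked.Linked⇒AllPairs >-trans desc)

  head>tail : ∀ {x xs z} → Linked (_>_ on v) (x ∷ xs) → z ∈ xs → v z < v x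
  head>tail desc z∈xs with Linked.Linked⇒AllPairs >-trans desc
  ... | x>xs ∷ _ = All.lookup x>xs z∈xs

  head≥ : ∀ {x xs z} → Linked (_>_ on v) (x ∷ xs) → z ∈ x ∷ xs → v z ≤ v x
  head≥ desc (here refl) = ≤-refl
  head≥ desc (there z∈xs) = <⇒≤ (head>tail desc z∈xs)

  descending-≡ : Injective _≡_ _≡_ v → ∀ {xs ys} → Linked (_>_ on v) xs → Linked (_>_ on v) ys
               → xs ⊆ ys → ys ⊆ xs → xs ≡ ys
  descending-≡ _ {[]} {[]} _ _ _ _ = refl
  descending-≡ _ {[]} {_ ∷ _} _ _ _ ys⊆xs with () ← ys⊆xs (here refl)
  descending-≡ _ {_ ∷ _} {[]} _ _ xs⊆ys _ with () ← xs⊆ys (here refl)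
  descending-≡ v-inj {x ∷ xs} {y ∷ ys} dx dy xs⊆ys ys⊆xs
    with v-inj (≤-antisym (head≥ dy (xs⊆ys (here refl))) (head≥ dx (ys⊆xs (here refl))))
  ... | refl = cong (x ∷_) (descending-≡ v-inj (Linked.tail dx) (Linked.tail dy)
                                          (tail⊆ dx xs⊆ys) (tail⊆ dy ys⊆xs))
    where
    tail⊆ : ∀ {us ws} → Linked (_>_ on v) (x ∷ us) → x ∷ us ⊆ x ∷ ws → us ⊆ ws
    tail⊆ desc sub z∈us =
      Any.tail (λ z≡x → <-irrefl (cong v z≡x) (head>tail desc z∈us)) (sub (there z∈us))

length≤width : ∀ {n} {I J : Fin n} {xs} → Unique xs → All (InRange I J) xs
             → length xs ≤ suc (toℕ J) ∸ toℕ I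
length≤width {I = I} {J} {xs} xs! xs∈IJ = begin
    length xs                       ≡⟨ length-map toℕ xs ⟨
    length (map toℕ xs)             ≤⟨ unique-⊆⇒length≤ (Unique.map⁺ toℕ-injective xs!) ⊆interval ⟩
    length (applyUpTo (toℕ I +_) w) ≡⟨ length-applyUpTo (toℕ I +_) w ⟩
    w                               ∎
  where
  open ≤-Reasoning
  w : ℕ
  w = suc (toℕ J) ∸ toℕ I
  ⊆interval : map toℕ xs ⊆ applyUpTo (toℕ I +_) w
  ⊆interval t∈ with ∈-map⁻ toℕ t∈
  ... | x , x∈xs , refl with All.lookup xs∈IJ x∈xs
  ... | I≤x , x≤J =
    subst (_∈ _) (m+[n∸m]≡n I≤x) (∈-applyUpTo⁺ (toℕ I +_) (∸-monoˡ-< (s≤s x≤J) I≤x))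

module TopK {n} (A : Array n) (k : ℕ) where
  open Descending (val A)
  open import Data.List.Membership.DecPropositional (_≟ᶠ_ {n}) using (_∈?_)

  Top : Fin n → Fin n → List (Fin n) → Set
  Top = IsSortedTopK A k

  top-unique : ∀ {I J L} → Top I J L → Unique L
  top-unique (_ , _ , desc , _) = descending⇒unique desc

  dominated∉top : ∀ {I J L z ws} → Top I J L → Unique ws → k ≤ length ws → All (InRange I J) ws
                → All (λ w → val A z < val A w) ws → z ∉ L
  dominated∉top {I} {J} {L} {z} {ws} (|L| , _ , _ , beaten) ws! k≤|ws| ws∈IJ z<ws z∈L =
    <-irrefl refl (begin-strict
      k                         ≤⟨ k≤|ws| ⟩
      length ws                 <⟨ ≤-refl ⟩
      length (z ∷ ws)           ≤⟨ unique-⊆⇒length≤ z∷ws! z∷ws⊆L ⟩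
      length L                  ≡⟨ |L| ⟩
      k ⊓ (suc (toℕ J) ∸ toℕ I) ≤⟨ m⊓n≤m k _ ⟩
      k                         ∎)
    where
    open ≤-Reasoning
    z∷ws! : Unique (z ∷ ws)
    z∷ws! = All.map (λ z<w z≡w → <-irrefl (cong (val A) z≡w) z<w) z<ws ∷ ws!
    z∷ws⊆L : z ∷ ws ⊆ L
    z∷ws⊆L (here refl) = z∈L
    z∷ws⊆L {w} (there w∈ws) with w ∈? L
    ... | yes w∈L = w∈L
    ... | no w∉L =
      ⊥-elim (<-asym (All.lookup (beaten w (All.lookup ws∈IJ w∈ws) w∉L) z∈L) (All.lookup z<ws w∈ws))

  top-restrict : ∀ {I J J′ L L′ z} → toℕ J ≤ toℕ J′ → Top I J L → Top I J′ L′
               → InRange I J z → z ∈ L′ → z ∈ L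
  top-restrict {I} {J} {L = L} {z = z} J≤J′ top@(|L| , L∈IJ , _ , beaten) top′ z∈IJ z∈L′ with z ∈? L
  ... | yes z∈L = z∈L
  ... | no z∉L with ⊓-sel k (suc (toℕ J) ∸ toℕ I)
  ...   | inj₁ k⊓w≡k =
    ⊥-elim (dominated∉top top′ (top-unique top) (≤-reflexive (trans (sym k⊓w≡k) (sym |L|)))
                          (All.map (λ (I≤y , y≤J) → I≤y , ≤-trans y≤J J≤J′) L∈IJ) (beaten z z∈IJ z∉L) z∈L′)
  ...   | inj₂ k⊓w≡w =
    ⊥-elim (<-irrefl (trans |L| k⊓w≡w) (length≤width (∉⇒unique-∷ z∉L (top-unique top)) (z∈IJ ∷ L∈IJ)))

  -- Extending the range adds a single candidate, which can push out only one element.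
  top-leaving-unique : ∀ {I J J′ L L′ x y} → toℕ J′ ≡ suc (toℕ J) → Top I J L → Top I J′ L′
                     → x ∈ L → x ∉ L′ → y ∈ L → y ∉ L′ → x ≡ y
  top-leaving-unique {I} {J} {J′} {L} {L′} {x} {y} J′≡1+J
                     top@(|L| , L∈IJ , _ , _) top′@(|L′| , L′∈IJ′ , _ , _) x∈L x∉L′ y∈L y∉L′
                     with x ≟ᶠ y
  ... | yes x≡y = x≡y
  ... | no x≢y = ⊥-elim (<-irrefl refl (begin-strict
      length L                      ≡⟨ |L| ⟩
      k ⊓ w                         ≤⟨ ⊓-monoʳ-≤ k (n≤1+n w) ⟩
      k ⊓ suc w                     ≡⟨ cong (k ⊓_) w′≡1+w ⟨
      k ⊓ (suc (toℕ J′) ∸ toℕ I)    ≡⟨ |L′| ⟨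
      length L′                     <⟨ s≤s⁻¹ (unique-⊆⇒length≤ x∷y∷L′! x∷y∷L′⊆J′∷L) ⟩
      length L                      ∎))
    where
    open ≤-Reasoning
    w : ℕ
    w = suc (toℕ J) ∸ toℕ I
    w′≡1+w : suc (toℕ J′) ∸ toℕ I ≡ suc w
    w′≡1+w with I≤x , x≤J ← All.lookup L∈IJ x∈L =
      trans (cong (λ j → suc j ∸ toℕ I) J′≡1+J) (+-∸-assoc 1 (m≤n⇒m≤1+n (≤-trans I≤x x≤J)))
    x∷y∷L′! : Unique (x ∷ y ∷ L′)
    x∷y∷L′! = ∉⇒unique-∷ (λ { (here x≡y) → x≢y x≡y ; (there x∈L′) → x∉L′ x∈L′ })
                          (∉⇒unique-∷ y∉L′ (top-unique top′))
    x∷y∷L′⊆J′∷L : x ∷ y ∷ L′ ⊆ J′ ∷ L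
    x∷y∷L′⊆J′∷L (here refl) = there x∈L
    x∷y∷L′⊆J′∷L (there (here refl)) = there y∈L
    x∷y∷L′⊆J′∷L {w} (there (there w∈L′)) with w ≟ᶠ J′ | All.lookup L′∈IJ′ w∈L′
    ... | yes w≡J′ | _ = here w≡J′
    ... | no w≢J′ | I≤w , w≤J′ =
      there (top-restrict J≤J′ top top′ (I≤w , s≤s⁻¹ (subst (toℕ w <_) J′≡1+J w<J′)) w∈L′)
      where
      J≤J′ : toℕ J ≤ toℕ J′
      J≤J′ = subst (toℕ J ≤_) (sym J′≡1+J) (n≤1+n (toℕ J))
      w<J′ : toℕ w < toℕ J′
      w<J′ = ≤∧≢⇒< w≤J′ (w≢J′ ∘ toℕ-injective)

Enumerates : ∀ {n} → List (Fin n) → Subset n → Set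
Enumerates L S = ∀ x → (x ∈ₛ S → x ∈ L) × (x ∈ L → x ∈ₛ S)

module Walk {n} (T : Fin n → Subset n) (j : ℕ) where

  Enters : Fin n → Fin n → Fin n → Set
  Enters J J′ z = toℕ z ≤ j × z ∈ₛ T J × ¬ (z ∈ₛ T J′)

  enters? : ∀ J J′ → Decidable (Enters J J′)
  enters? J J′ z = (toℕ z ≤? j) ×-dec (z ∈ₛ? T J) ×-dec ¬? (z ∈ₛ? T J′)

  entering : Fin n → Fin n → List (Fin n)
  entering J J′ = filter (enters? J J′) (allFin n)

  -- The positions ≤ j entering the answer as the right end shrinks from e + c to e, in order of entry.
  walk : (e c : ℕ) → .(e + c < n) → List (Fin n)
  walk e zero    _  = []
  walk e (suc c) lt =
    walk (suc e) c (subst (_< n) (+-suc e c) lt)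
    ++ entering (fromℕ< (m+n≤o⇒m≤o (suc e) lt))
                (fromℕ< (m+n≤o⇒m≤o (suc (suc e)) (subst (_< n) (+-suc e c) lt)))

module WalkCorrect {n} (A : Array n) (k : ℕ) (T : Fin n → Subset n) (I : Fin n)
                   (correct : ∀ J → toℕ I ≤ toℕ J → IsUnsortedTopK A k I J (T J)) (j : ℕ) where
  open Descending (val A)
  open TopK A k
  open Walk T j
  open import Data.List.Membership.DecPropositional (_≟ᶠ_ {n}) using (_∈?_)

  Answer : Fin n → List (Fin n) → Set
  Answer J L = Top I J L × Enumerates L (T J)

  answer-unique : ∀ {J L L′} → Answer J L → Answer J L′ → L ≡ L′
  answer-unique ((_ , _ , desc , _) , L≐T) ((_ , _ , desc′ , _) , L′≐T) =
    descending-≡ (proj₂ A) desc desc′ (λ {z} → proj₁ (L′≐T z) ∘ proj₂ (L≐T z))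
                                      (λ {z} → proj₁ (L≐T z) ∘ proj₂ (L′≐T z))

  low? : Decidable (λ (z : Fin n) → toℕ z ≤ j)
  low? z = toℕ z ≤? j

  entering-step : ∀ {J J′ L L′} → toℕ J′ ≡ suc (toℕ J) → j ≤ toℕ J → Answer J L → Answer J′ L′
                → filter low? L ≡ filter low? L′ ++ entering J J′
  entering-step {J} {J′} {L} {L′} J′≡1+J j≤J
                (top@(_ , L∈IJ , desc , _) , L≐T) (top′@(_ , L′∈IJ′ , desc′ , beaten′) , L′≐T) =
    descending-≡ (proj₂ A) (Linked.filter⁺ low? >-trans desc)
                 (linked-++⁺ (Linked.filter⁺ low? >-trans desc′) entering-desc entering<L′) ⊆rhs ⊆lhs
    where
    J≤J′ : toℕ J ≤ toℕ J′
    J≤J′ = subst (toℕ J ≤_) (sym J′≡1+J) (n≤1+n (toℕ J))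

    ∈-entering⁻ : ∀ {z} → z ∈ entering J J′ → toℕ z ≤ j × z ∈ L × z ∉ L′
    ∈-entering⁻ {z} z∈ with _ , z≤j , z∈T , z∉T′ ← ∈-filter⁻ (enters? J J′) {xs = allFin n} z∈ =
      z≤j , proj₁ (L≐T z) z∈T , z∉T′ ∘ proj₂ (L′≐T z)

    ∈-entering⁺ : ∀ {z} → toℕ z ≤ j → z ∈ L → z ∉ L′ → z ∈ entering J J′
    ∈-entering⁺ {z} z≤j z∈L z∉L′ =
      ∈-filter⁺ (enters? J J′) (∈-allFin z) (z≤j , proj₂ (L≐T z) z∈L , z∉L′ ∘ proj₁ (L′≐T z))

    entering-desc : Linked (_>_ on val A) (entering J J′)
    entering-desc = linked-≤1 (Unique.filter⁺ (enters? J J′) (Unique.allFin⁺ n)) λ x∈ y∈ →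
      let _ , x∈L , x∉L′ = ∈-entering⁻ x∈
          _ , y∈L , y∉L′ = ∈-entering⁻ y∈
      in top-leaving-unique J′≡1+J top top′ x∈L x∉L′ y∈L y∉L′

    entering<L′ : ∀ {x y} → x ∈ filter low? L′ → y ∈ entering J J′ → val A y < val A x
    entering<L′ x∈ y∈ with _ , y∈L , y∉L′ ← ∈-entering⁻ y∈ with I≤y , y≤J ← All.lookup L∈IJ y∈L =
      All.lookup (beaten′ _ (I≤y , ≤-trans y≤J J≤J′) y∉L′) (proj₁ (∈-filter⁻ low? x∈))

    ⊆rhs : filter low? L ⊆ filter low? L′ ++ entering J J′
    ⊆rhs {z} z∈ with z∈L , z≤j ← ∈-filter⁻ low? z∈ with z ∈? L′
    ... | yes z∈L′ = ∈-++⁺ˡ (∈-filter⁺ low? z∈L′ z≤j)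
    ... | no z∉L′ = ∈-++⁺ʳ _ (∈-entering⁺ z≤j z∈L z∉L′)

    ⊆lhs : filter low? L′ ++ entering J J′ ⊆ filter low? L
    ⊆lhs z∈ with ∈-++⁻ (filter low? L′) z∈
    ... | inj₁ z∈ with z∈L′ , z≤j ← ∈-filter⁻ low? z∈ =
      ∈-filter⁺ low? (top-restrict J≤J′ top top′ (proj₁ (All.lookup L′∈IJ′ z∈L′) , ≤-trans z≤j j≤J) z∈L′)
                     z≤j
    ... | inj₂ z∈ with z≤j , z∈L , _ ← ∈-entering⁻ z∈ = ∈-filter⁺ low? z∈L z≤j

  walk-spec : ∀ c e .(lt : e + c < n) → toℕ I ≤ e → j ≤ e → ∀ {J′ L L′}
            → Answer (fromℕ< (m+n≤o⇒m≤o (suc e) lt)) L → toℕ J′ ≡ e + c → Answer J′ L′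
            → filter low? L ≡ filter low? L′ ++ walk e c lt
  walk-spec zero e lt _ _ {J′} {L} {L′} ans J′≡e+0 ans′ = begin
      filter low? L         ≡⟨ cong (filter low?) L≡L′ ⟩
      filter low? L′        ≡⟨ ++-identityʳ (filter low? L′) ⟨
      filter low? L′ ++ []  ∎
    where
    open ≡-Reasoning
    J′≡J : J′ ≡ fromℕ< (m+n≤o⇒m≤o (suc e) lt)
    J′≡J = toℕ-injective (trans J′≡e+0 (trans (+-identityʳ e)
                                              (sym (toℕ-fromℕ< (m+n≤o⇒m≤o (suc e) lt)))))
    L≡L′ : L ≡ L′
    L≡L′ = answer-unique ans (subst (λ J → Answer J L′) J′≡J ans′)
  walk-spec (suc c) e lt I≤e j≤e {J′} {L} {L′} ans J′≡ ans′ = via (correct J₂ I≤J₂)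
    where
    open ≡-Reasoning
    J₁ J₂ : Fin n
    J₁ = fromℕ< (m+n≤o⇒m≤o (suc e) lt)
    J₂ = fromℕ< (m+n≤o⇒m≤o (suc (suc e)) (subst (_< n) (+-suc e c) lt))
    toℕ-J₁ : toℕ J₁ ≡ e
    toℕ-J₁ = toℕ-fromℕ< (m+n≤o⇒m≤o (suc e) lt)
    toℕ-J₂ : toℕ J₂ ≡ suc e
    toℕ-J₂ = toℕ-fromℕ< (m+n≤o⇒m≤o (suc (suc e)) (subst (_< n) (+-suc e c) lt))
    I≤J₂ : toℕ I ≤ toℕ J₂
    I≤J₂ = subst (toℕ I ≤_) (sym toℕ-J₂) (m≤n⇒m≤1+n I≤e)
    via : IsUnsortedTopK A k I J₂ (T J₂) → filter low? L ≡ filter low? L′ ++ walk e (suc c) lt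
    via (L₂ , ans₂) = begin
      filter low? L
        ≡⟨ entering-step (trans toℕ-J₂ (cong suc (sym toℕ-J₁))) (subst (j ≤_) (sym toℕ-J₁) j≤e) ans ans₂ ⟩
      filter low? L₂ ++ entering J₁ J₂
        ≡⟨ cong (_++ entering J₁ J₂) (walk-spec c (suc e) (subst (_< n) (+-suc e c) lt) (m≤n⇒m≤1+n I≤e)
                                                (m≤n⇒m≤1+n j≤e) ans₂ (trans J′≡ (+-suc e c)) ans′) ⟩
      (filter low? L′ ++ walk (suc e) c (subst (_< n) (+-suc e c) lt)) ++ entering J₁ J₂
        ≡⟨ ++-assoc (filter low? L′) _ _ ⟩
      filter low? L′ ++ walk e (suc c) lt
        ∎

splitAt-injective : ∀ m {p} → Injective _≡_ _≡_ (splitAt m {p})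
splitAt-injective m {p} {z} {z′} eq = begin
    z                       ≡⟨ join-splitAt m p z ⟨
    join m p (splitAt m z)  ≡⟨ cong (join m p) eq ⟩
    join m p (splitAt m z′) ≡⟨ join-splitAt m p z′ ⟩
    z′                      ∎
  where open ≡-Reasoning

lowers : ∀ m {p} → List (Fin (m + p)) → List (Fin m)
lowers m = mapMaybe (isInj₁ ∘ splitAt m)

map-↑ˡ-lowers : ∀ m {p} {zs : List (Fin (m + p))} → All (λ z → toℕ z < m) zs
              → map (_↑ˡ p) (lowers m zs) ≡ zs
map-↑ˡ-lowers m [] = refl
map-↑ˡ-lowers m {p} {z ∷ _} (z<m ∷ zs<m) rewrite splitAt-< m z z<m =
  cong₂ _∷_ (splitAt⁻¹-↑ˡ (splitAt-< m z z<m)) (map-↑ˡ-lowers m zs<m)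

module Prefix {m p} (A : Array (m + p)) (B : Array m) (A-↑ˡ : ∀ x → val A (x ↑ˡ p) ≡ val B x)
              {k : ℕ} {i j : Fin m} where

  top-↑ˡ⁻ : ∀ {L} → IsSortedTopK A k (i ↑ˡ p) (j ↑ˡ p) (map (_↑ˡ p) L) → IsSortedTopK B k i j L
  top-↑ˡ⁻ {L} (|L| , L∈IJ , desc , beaten) = |L|′ , All.map inRange⁻ (All.map⁻ L∈IJ) , desc′ , beaten′
    where
    inRange⁻ : ∀ {x} → InRange (i ↑ˡ p) (j ↑ˡ p) (x ↑ˡ p) → InRange i j x
    inRange⁻ {x} (I≤x , x≤J) = subst₂ _≤_ (toℕ-↑ˡ i p) (toℕ-↑ˡ x p) I≤x
                             , subst₂ _≤_ (toℕ-↑ˡ x p) (toℕ-↑ˡ j p) x≤J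

    inRange⁺ : ∀ {x} → InRange i j x → InRange (i ↑ˡ p) (j ↑ˡ p) (x ↑ˡ p)
    inRange⁺ {x} (i≤x , x≤j) = subst₂ _≤_ (sym (toℕ-↑ˡ i p)) (sym (toℕ-↑ˡ x p)) i≤x
                             , subst₂ _≤_ (sym (toℕ-↑ˡ x p)) (sym (toℕ-↑ˡ j p)) x≤j

    |L|′ : length L ≡ k ⊓ (suc (toℕ j) ∸ toℕ i)
    |L|′ = trans (sym (length-map (_↑ˡ p) L))
                 (trans |L| (cong₂ (λ a b → k ⊓ (suc a ∸ b)) (toℕ-↑ˡ j p) (toℕ-↑ˡ i p)))

    desc′ : Linked (λ x y → val B y < val B x) L
    desc′ = Linked.map (λ {x} {y} → subst₂ _<_ (A-↑ˡ y) (A-↑ˡ x)) (Linked.map⁻ desc)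

    beaten′ : ∀ x → InRange i j x → x ∉ L → All (λ y → val B x < val B y) L
    beaten′ x x∈ij x∉L = All.map (λ {y} → subst₂ _<_ (A-↑ˡ x) (A-↑ˡ y))
                                 (All.map⁻ (beaten (x ↑ˡ p) (inRange⁺ x∈ij) x↑∉L↑))
      where
      x↑∉L↑ : x ↑ˡ p ∉ map (_↑ˡ p) L
      x↑∉L↑ x↑∈L↑ with y , y∈L , x↑≡y↑ ← ∈-map⁻ (_↑ˡ p) x↑∈L↑ =
        x∉L (subst (_∈ L) (sym (↑ˡ-injective p x y x↑≡y↑)) y∈L)

  top-lowers : ∀ {L} → IsSortedTopK A k (i ↑ˡ p) (j ↑ˡ p) L → IsSortedTopK B k i j (lowers m L)
  top-lowers {L} top@(_ , L∈IJ , _ , _) =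
    top-↑ˡ⁻ (subst (IsSortedTopK A k _ _) (sym (map-↑ˡ-lowers m L<m)) top)
    where
    L<m : All (λ z → toℕ z < m) L
    L<m = All.map (λ (_ , z≤J) → ≤-<-trans z≤J (subst (_< m) (sym (toℕ-↑ˡ j p)) (toℕ<n j))) L∈IJ

module Padding (p : ℕ) {m} (B : Array m) where

  bound : ℕ
  bound = max 0 (map (val B) (allFin m))

  value : Fin m ⊎ Fin p → ℕ
  value (inj₁ x) = val B x
  value (inj₂ y) = suc (bound + toℕ y)

  low<high : ∀ x y → value (inj₁ x) < value (inj₂ y)
  low<high x y =
    s≤s (≤-trans (All.lookup (xs≤max 0 (map (val B) (allFin m))) (∈-map⁺ (val B) (∈-allFin x)))
                 (m≤m+n bound (toℕ y)))

  value-injective : Injective _≡_ _≡_ value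
  value-injective {inj₁ x} {inj₁ x′} eq = cong inj₁ (proj₂ B eq)
  value-injective {inj₁ x} {inj₂ y} eq = ⊥-elim (<-irrefl eq (low<high x y))
  value-injective {inj₂ y} {inj₁ x} eq = ⊥-elim (<-irrefl (sym eq) (low<high x y))
  value-injective {inj₂ y} {inj₂ y′} eq =
    cong inj₂ (toℕ-injective (+-cancelˡ-≡ bound _ _ (suc-injective eq)))

  padded : Array (m + p)
  padded = value ∘ splitAt m , splitAt-injective m ∘ value-injective

  padded-↑ˡ : ∀ x → val padded (x ↑ˡ p) ≡ val B x
  padded-↑ˡ x = cong value (splitAt-↑ˡ m x p)

  padded-low<high : ∀ {z} → toℕ z < m → ∀ y → val padded z < val padded (m ↑ʳ y)
  padded-low<high {z} z<m y = subst₂ _<_ (cong value (sym (splitAt-< m z z<m)))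
                                          (cong value (sym (splitAt-↑ʳ m p y))) (low<high _ y)

module Reduction (m k′ : ℕ) where

  k n : ℕ
  k = suc k′
  n = m + k

  last : Fin n
  last = m ↑ʳ fromℕ k′

  toℕ-last : toℕ last ≡ m + k′
  toℕ-last = trans (toℕ-↑ʳ m (fromℕ k′)) (cong (m +_) (toℕ-fromℕ k′))

  start : Fin m → ℕ
  start j = toℕ (j ↑ˡ k)

  start<m : ∀ j → start j < m
  start<m j = subst (_< m) (sym (toℕ-↑ˡ j k)) (toℕ<n j)

  start≤last : ∀ j → start j ≤ toℕ last
  start≤last j = subst (start j ≤_) (sym toℕ-last) (≤-trans (<⇒≤ (start<m j)) (m≤m+n m k′))

  fits : ∀ j → start j + (toℕ last ∸ start j) < n
  fits j = subst (_< n) (sym (m+[n∸m]≡n (start≤last j))) (toℕ<n last)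

  decode : (Fin n → Fin n → Subset n) → Fin m → Fin m → List (Fin m)
  decode S i j = lowers m (Walk.walk (S (i ↑ˡ k)) (start j) (start j) (toℕ last ∸ start j) (fits j))

  module _ (B : Array m) where
    open Padding k B
    open TopK padded k

    top-to-last-in-padding : ∀ {i : Fin m} {L z} → Top (i ↑ˡ k) last L → z ∈ L → m ≤ toℕ z
    top-to-last-in-padding {i} {z = z} top z∈L with m ≤? toℕ z
    ... | yes m≤z = m≤z
    ... | no m≰z = ⊥-elim (dominated∉top top (Unique.tabulate⁺ (↑ʳ-injective m _ _))
                                         (≤-reflexive (sym (length-tabulate (m ↑ʳ_))))
                                         (All.tabulate⁺ high∈range)
                                         (All.tabulate⁺ (padded-low<high (≰⇒> m≰z))) z∈L)
      where
      high∈range : ∀ y → InRange (i ↑ˡ k) last (m ↑ʳ y)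
      high∈range y =
          subst₂ _≤_ (sym (toℕ-↑ˡ i k)) (sym (toℕ-↑ʳ m y)) (≤-trans (<⇒≤ (toℕ<n i)) (m≤m+n m (toℕ y)))
        , subst₂ _≤_ (sym (toℕ-↑ʳ m y)) (sym toℕ-last) (+-monoʳ-≤ m (s≤s⁻¹ (toℕ<n y)))

    decode-correct : (S : Fin n → Fin n → Subset n)
                   → (∀ I J → toℕ I ≤ toℕ J → IsUnsortedTopK padded k I J (S I J))
                   → ∀ i j → toℕ i ≤ toℕ j → IsSortedTopK B k i j (decode S i j)
    decode-correct S correct i j i≤j =
      via (correct I J₀ I≤J₀) (correct I last (≤-trans I≤e (start≤last j)))
      where
      I J₀ : Fin n
      I = i ↑ˡ k
      e : ℕ
      e = start j
      J₀ = fromℕ< (m+n≤o⇒m≤o (suc e) (fits j))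
      toℕ-J₀ : toℕ J₀ ≡ e
      toℕ-J₀ = toℕ-fromℕ< (m+n≤o⇒m≤o (suc e) (fits j))
      I≤e : toℕ I ≤ e
      I≤e = subst₂ _≤_ (sym (toℕ-↑ˡ i k)) (sym (toℕ-↑ˡ j k)) i≤j
      I≤J₀ : toℕ I ≤ toℕ J₀
      I≤J₀ = subst (toℕ I ≤_) (sym toℕ-J₀) I≤e
      open WalkCorrect padded k (S I) I (correct I) e
      via : IsUnsortedTopK padded k I J₀ (S I J₀) → IsUnsortedTopK padded k I last (S I last)
          → IsSortedTopK B k i j (decode S i j)
      via (L , ans@(top@(_ , L∈IJ₀ , _) , _)) (L′ , ans′@(top′ , _)) =
        subst (IsSortedTopK B k i j) (cong (lowers m) L≡walk)
              (Prefix.top-lowers padded B padded-↑ˡ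
                                 (subst (λ J → Top I J L) (fromℕ<-toℕ (j ↑ˡ k) _) top))
        where
        open ≡-Reasoning
        L≤e : All (λ z → toℕ z ≤ e) L
        L≤e = All.map (λ {z} (_ , z≤J₀) → subst (toℕ z ≤_) toℕ-J₀ z≤J₀) L∈IJ₀
        L′≰e : All (λ z → ¬ (toℕ z ≤ e)) L′
        L′≰e = All.tabulate λ z∈L′ z≤e →
          <⇒≱ (≤-<-trans z≤e (start<m j)) (top-to-last-in-padding top′ z∈L′)
        L≡walk : L ≡ Walk.walk (S I) e e (toℕ last ∸ e) (fits j)
        L≡walk = begin
          L                                  ≡⟨ filter-all low? L≤e ⟨
          filter low? L                      ≡⟨ walk-spec (toℕ last ∸ e) e (fits j) I≤e ≤-refl ans
                                                          (sym (m+[n∸m]≡n (start≤last j))) ans′ ⟩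
          filter low? L′ ++ Walk.walk (S I) e e (toℕ last ∸ e) (fits j)
                                             ≡⟨ cong (_++ _) (filter-none low? L′≰e) ⟩
          Walk.walk (S I) e e (toℕ last ∸ e) (fits j) ∎

  sorted-from-unsorted : ∀ {b} → UnsortedEncodable k n b → SortedEncodable k m b
  sorted-from-unsorted (enc , dec , correct) =
    enc ∘ Padding.padded k , decode ∘ dec , λ B → decode-correct B _ (correct (Padding.padded k B))

sorted-empty : ∀ k b → SortedEncodable k 0 b
sorted-empty k b = (λ _ → replicate b false) , (λ _ ()) , (λ _ ())

lemma16 : ∀ (n k : ℕ) → 1 ≤ k → ∀ (s : ℕ)
          → IsBitsRequired (SortedEncodable k) (n ∸ k) s
          → ∀ (b : ℕ) → UnsortedEncodable k n b → s ≤ b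
lemma16 n zero ()
lemma16 n (suc k′) _ s (_ , minimal) b unsorted with suc k′ ≤? n
... | yes k≤n = minimal b (Reduction.sorted-from-unsorted (n ∸ suc k′) k′
                             (subst (λ n → UnsortedEncodable (suc k′) n b) (sym (m∸n+n≡m k≤n)) unsorted))
... | no k≰n = minimal b (subst (λ m → SortedEncodable (suc k′) m b)
                                (sym (m≤n⇒m∸n≡0 (<⇒≤ (≰⇒> k≰n)))) (sorted-empty (suc k′) b))
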